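{- Let $L$ be a bounded distributive lattice (with $0\neq 1$), and let $\Phi(L)=\{(a,b)\in L\times L : a\le b\}$, ordered coordinatewise. If $S$ is an ideal of the lattice $\Phi(L)$, then $$S=(pr_1(S)\times pr_2(S))\cap \Phi(L),$$ where $pr_j:L\times L\to L$ is given by $(l_1,l_2)\mapsto l_j$ for $j=1,2$.
   Context: $\Phi(L)$ is a $(0,1)$-sublattice of $L\times L$ (operations componentwise). An ideal of a lattice is a nonempty down-set closed under binary joins. -}

module Defs where

open import Level using (Level; _⊔_; suc)
open import Data.Product using (Σ; ∃; _×_; _,_; proj₁; proj₂)
open import Relation.Nullary using (¬_)
open import Relation.Binary.Lattice using (BoundedLattice)
open import Algebra.Definitions using (_DistributesOverˡ_)

record BoundedDistributiveLattice c ℓ₁ ℓ₂ : Set (suc (c ⊔ ℓ₁ ⊔ ℓ₂)) where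
  field
    boundedLattice : BoundedLattice c ℓ₁ ℓ₂
  open BoundedLattice boundedLattice public
  field
    ∧-distribˡ-∨ : _DistributesOverˡ_ _≈_ _∧_ _∨_
    ⊥≉⊤          : ¬ (⊥ ≈ ⊤)

module _ {c ℓ₁ ℓ₂ : Level} (L : BoundedDistributiveLattice c ℓ₁ ℓ₂) where
  open BoundedDistributiveLattice L

  InΦ : Carrier × Carrier → Set ℓ₂
  InΦ (a , b) = a ≤ b

  -- Subsets of Φ(L), given as predicates on pairs (the predicate is only
  -- consulted on pairs lying in Φ(L)).
  SubsetΦ : (ℓ : Level) → Set (c ⊔ suc ℓ)
  SubsetΦ ℓ = Carrier × Carrier → Set ℓ

  record IsIdealΦ {ℓ : Level} (S : SubsetΦ ℓ) : Set (c ⊔ ℓ₁ ⊔ ℓ₂ ⊔ ℓ) where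
    field
      ⊆Φ        : ∀ p → S p → InΦ p
      nonempty  : ∃ λ p → S p
      downClosed : ∀ a b a' b' → a' ≤ b' → a' ≤ a → b' ≤ b →
                   S (a , b) → S (a' , b')
      joinClosed : ∀ a b a' b' → S (a , b) → S (a' , b') →
                   S (a ∨ a' , b ∨ b')

  pr₁ : {ℓ : Level} → SubsetΦ ℓ → Carrier → Set (c ⊔ ℓ)
  pr₁ S a = ∃ λ y → S (a , y)

  pr₂ : {ℓ : Level} → SubsetΦ ℓ → Carrier → Set (c ⊔ ℓ)
  pr₂ S b = ∃ λ x → S (x , b)

  ProdΦ : {ℓ : Level} → SubsetΦ ℓ → Carrier × Carrier → Set (c ⊔ ℓ₂ ⊔ ℓ)
  ProdΦ S (a , b) = pr₁ S a × pr₂ S b × InΦ (a , b)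

module Submission where

open import Defs
open import Level using (Level)
open import Data.Product using (_×_; _,_)

-- The inclusion S ⊆ (pr₁ S × pr₂ S) ∩ Φ(L) is immediate: each
-- pair (a , b) ∈ S witnesses a ∈ pr₁ S and b ∈ pr₂ S, and S ⊆ Φ(L).
-- For the converse let a ∈ pr₁ S and b ∈ pr₂ S with a ≤ b, witnessed by
-- (a , y) ∈ S and (x , b) ∈ S.  Since S is join-closed, the coordinatewise
-- join (a ∨ x , y ∨ b) lies in S; it dominates (a , b) in both coordinates,
-- so (a , b) ∈ S because S is a down-set in Φ(L).

module _ {c ℓ₁ ℓ₂ ℓ : Level} (L : BoundedDistributiveLattice c ℓ₁ ℓ₂)
         {S : SubsetΦ L ℓ} (ideal : IsIdealΦ L S) where

  open BoundedDistributiveLattice L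
  open IsIdealΦ ideal

  -- An ideal of Φ(L) contains every element of Φ(L) whose first coordinate
  -- occurs as a first coordinate in S and whose second coordinate occurs as
  -- a second coordinate in S: it lies below the join of the two witnesses.
  ideal-recombine : ∀ {a b x y} → a ≤ b → S (a , y) → S (x , b) → S (a , b)
  ideal-recombine {a} {b} {x} {y} a≤b s₁ s₂ =
    downClosed (a ∨ x) (y ∨ b) a b a≤b (x≤x∨y a x) (y≤x∨y y b) joinInS
    where
    joinInS : S (a ∨ x , y ∨ b)
    joinInS = joinClosed a y x b s₁ s₂

  ideal⊆ProdΦ : ∀ p → S p → ProdΦ L S p
  ideal⊆ProdΦ (a , b) s = (b , s) , (a , s) , ⊆Φ (a , b) s

  ProdΦ⊆ideal : ∀ p → ProdΦ L S p → S p
  ProdΦ⊆ideal (a , b) ((_ , s₁) , (_ , s₂) , a≤b) = ideal-recombine a≤b s₁ s₂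

lemma4p1 : {c ℓ₁ ℓ₂ ℓ : Level} (L : BoundedDistributiveLattice c ℓ₁ ℓ₂) →
    (S : SubsetΦ L ℓ) → IsIdealΦ L S →
    (∀ p → S p → ProdΦ L S p) × (∀ p → ProdΦ L S p → S p)
lemma4p1 L S ideal = ideal⊆ProdΦ L ideal , ProdΦ⊆ideal L ideal
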